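{- There is an absolute constant $C$ such that the following holds. Let Off be an MTF-based offline algorithm. Fix any step and consider its second stage, which happens after DLM has completed its processing of the step. In this stage Off moves some element $z$ to the front of its list, at cost $\Delta\mathrm{Off}=\pi^*(z)-1$, where $\pi^*(z)$ is the position before the move, while DLM's permutation and budgets are unchanged. Then $$\Delta\Phi+\Delta\Psi\le C\,r^2\cdot\Delta\mathrm{Off},$$ i.e., $\Delta\Phi+\Delta\Psi=O(r^2)\cdot\Delta\mathrm{Off}$.
   Context: Online Min-Sum Set Cover with requests of cardinality at most $r$, over a universe $\mathcal U$ of $n$ elements. Lists are permutations $\mathcal U\to\{1,\dots,n\}$. Reordering costs one unit per swap of adjacent elements. An offline algorithm is MTF-based if, for each request $R$, it moves exactly one element of $R$ to the first position of its list (shifting the elements that preceded it back by one) and makes no other changes. Algorithm DLM. Every element $z$ has a budget $b(z)$, initially $0$. The operation fetch$(z)$ moves $z$ to position 1 by $\pi(z)-1$ adjacent swaps, so every element that preceded $z$ moves back by one position, and then sets $b(z)\gets0$. On a request $R$ with $|R|=s$, let $x\in R$ be the element of $R$ with the smallest current position and let $\ell=\pi(x)$. DLM pays $\ell$ and executes fetch$(x)$. For every $y\in R\setminus\{x\}$ it sets $b(y)\gets b(y)+\ell/s$. Then, while some $z$ has $b(z)\ge\pi(z)$, it executes fetch$(z)$. Potentials. Let $\pi$ be DLM's current permutation and $\pi^*$ the current permutation of Off. Write $\pi(z)=2^{p(z)}+q(z)$ with $p(z)\ge0$ an integer and $0\le q(z)\le 2^{p(z)}-1$, and analogously $\pi^*(z)=2^{p^*(z)}+q^*(z)$.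 Set $\alpha=2$, $\gamma=5r$, $\beta=7.5r+5$ and $\kappa=\lceil\log_2(6\beta)\rceil$. Define - $\Phi_z=\alpha\, b(z)$ if $p(z)\le p^*(z)+\kappa$, and $\Phi_z=\beta\,\pi(z)-\gamma\, b(z)$ if $p(z)\ge p^*(z)+\kappa+1$; - $\Psi_z=0$ if $p(z)\le p^*(z)+\kappa-1$, and $\Psi_z=2\beta\, q(z)$ if $p(z)\ge p^*(z)+\kappa$. Set $\Phi=\sum_z\Phi_z$ and $\Psi=\sum_z\Psi_z$. -}

module Defs where

open import Data.Bool using (Bool; true; false; if_then_else_; _∧_; not)
open import Data.Nat as ℕ using (ℕ; zero; suc; _∸_; _^_; _≤ᵇ_; _<ᵇ_)
open import Data.Nat.Logarithm using (⌊log₂_⌋; ⌈log₂_⌉)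
open import Data.Fin using (Fin; _≟_)
open import Data.List using (List; []; _∷_; length; filter; foldr; map; allFin)
open import Data.List.Membership.Propositional using (_∈_)
open import Data.List.Relation.Unary.Unique.Propositional using (Unique)
open import Data.Integer using (+_)
open import Data.Rational as ℚ using (ℚ; 0ℚ; _/_; _+_; _-_; _*_)
open import Relation.Nullary using (¬?)
open import Relation.Nullary.Decidable using (⌊_⌋)

⟦_⟧ : ℕ → ℚ
⟦ m ⟧ = + m / 1

-- Lists over the universe Fin n.  A list is represented by the sequence
-- of its elements, front first; it is always a permutation of allFin n.
-- The position of z is 1 + (index of z).

pos : {n : ℕ} → List (Fin n) → Fin n → ℕ
pos []       z = 0
pos (x ∷ xs) z = if ⌊ x ≟ z ⌋ then 1 else suc (pos xs z)

-- move z to the first position; the elements that preceded z move back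
-- by one, all others keep their positions (cost pos L z ∸ 1 adjacent swaps)
moveToFront : {n : ℕ} → Fin n → List (Fin n) → List (Fin n)
moveToFront z L = z ∷ filter (λ y → ¬? (y ≟ z)) L

_∈ᵇ_ : {n : ℕ} → Fin n → List (Fin n) → Bool
y ∈ᵇ []       = false
y ∈ᵇ (x ∷ xs) = if ⌊ x ≟ y ⌋ then true else (y ∈ᵇ xs)

record ValidRequest {n : ℕ} (r : ℕ) (R : List (Fin n)) : Set where
  field
    distinct : Unique R
    nonempty : 1 ℕ.≤ length R
    bounded  : length R ℕ.≤ r

share : {n : ℕ} → ℕ → List (Fin n) → ℚ
share ℓ []       = 0ℚ
share ℓ (a ∷ as) = (+ ℓ) / suc (length as)

record DLMState (n : ℕ) : Set where
  constructor ⟨_,_⟩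
  field
    list   : List (Fin n)
    budget : Fin n → ℚ
open DLMState public

fetch : {n : ℕ} → Fin n → DLMState n → DLMState n
fetch z ⟨ L , b ⟩ = ⟨ moveToFront z L , (λ y → if ⌊ y ≟ z ⌋ then 0ℚ else b y) ⟩

addBudgets : {n : ℕ} → List (Fin n) → Fin n → ℚ → DLMState n → DLMState n
addBudgets R x δ ⟨ L , b ⟩ =
  ⟨ L , (λ y → if (y ∈ᵇ R) ∧ not ⌊ y ≟ x ⌋ then b y + δ else b y) ⟩

-- "while some z has b(z) ≥ π(z), fetch(z)"  (any choice of z allowed)
data Cleanup {n : ℕ} : DLMState n → DLMState n → Set where
  done : ∀ {S} → (∀ z → budget S z ℚ.< ⟦ pos (list S) z ⟧) → Cleanup S S
  step : ∀ {S S'} (z : Fin n) →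
         ⟦ pos (list S) z ⟧ ℚ.≤ budget S z →
         Cleanup (fetch z S) S' → Cleanup S S'

-- One DLM step on request R: x is the element of R with the smallest
-- current position ℓ; DLM pays ℓ, fetches x, adds ℓ/s to the budgets of
-- R ∖ {x}, then runs the fetch loop until no z has b(z) ≥ π(z).
data DLMStep {n : ℕ} (R : List (Fin n)) (S : DLMState n) : DLMState n → Set where
  dlm : ∀ {S'} (x : Fin n) → x ∈ R →
        (∀ {y} → y ∈ R → pos (list S) x ℕ.≤ pos (list S) y) →
        Cleanup (addBudgets R x (share (pos (list S) x) R) (fetch x S)) S' →
        DLMStep R S S'

-- Configurations reachable after complete steps, on requests of size ≤ r,
-- with Off an arbitrary MTF-based algorithm; both start from list L₀,
-- all budgets 0.  Each step: DLM processes R, then Off moves some z ∈ R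
-- to the front of its list.
data Reachable {n : ℕ} (r : ℕ) (L₀ : List (Fin n)) :
               DLMState n → List (Fin n) → Set where
  start : Reachable r L₀ ⟨ L₀ , (λ _ → 0ℚ) ⟩ L₀
  next  : ∀ {S L S'} {R : List (Fin n)} {z : Fin n} →
          Reachable r L₀ S L → ValidRequest r R → DLMStep R S S' →
          z ∈ R → Reachable r L₀ S' (moveToFront z L)

-- π = 2^p + q with 0 ≤ q ≤ 2^p − 1
pexp : ℕ → ℕ
pexp m = ⌊log₂ m ⌋

qrem : ℕ → ℕ
qrem m = m ∸ 2 ^ ⌊log₂ m ⌋

αc : ℚ
αc = ⟦ 2 ⟧

γc : ℕ → ℚ
γc r = ⟦ 5 ℕ.* r ⟧

βc : ℕ → ℚ
βc r = (+ (15 ℕ.* r)) / 2 + ⟦ 5 ⟧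

-- κ = ⌈log₂ (6β)⌉ = ⌈log₂ (45 r + 30)⌉
κc : ℕ → ℕ
κc r = ⌈log₂ (45 ℕ.* r ℕ.+ 30) ⌉

sumℚ : {n : ℕ} → (Fin n → ℚ) → ℚ
sumℚ {n} f = foldr _+_ 0ℚ (map f (allFin n))

Φz : {n : ℕ} → ℕ → DLMState n → List (Fin n) → Fin n → ℚ
Φz r S L* z =
  let π = pos (list S) z ; π* = pos L* z in
  if pexp π ≤ᵇ pexp π* ℕ.+ κc r
  then αc * budget S z
  else βc r * ⟦ π ⟧ - γc r * budget S z

Ψz : {n : ℕ} → ℕ → DLMState n → List (Fin n) → Fin n → ℚ
Ψz r S L* z =
  let π = pos (list S) z ; π* = pos L* z in
  if pexp π <ᵇ pexp π* ℕ.+ κc r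
  then 0ℚ
  else ⟦ 2 ⟧ * βc r * ⟦ qrem π ⟧

Φ : {n : ℕ} → ℕ → DLMState n → List (Fin n) → ℚ
Φ r S L* = sumℚ (Φz r S L*)

Ψ : {n : ℕ} → ℕ → DLMState n → List (Fin n) → ℚ
Ψ r S L* = sumℚ (Ψz r S L*)

{-# OPTIONS --safe #-}
-- Only Off's list changes, and π* enters Φ and Ψ only through the thresholds
-- p*(w) + κ.  For w ≠ z, moving z to the front can only increase π*(w), hence
-- raise the threshold; since b(w) < π(w) after DLM's step we have
-- α b ≤ β π − γ b, so a higher threshold can only decrease Φ_w and Ψ_w.
-- For z the threshold drops to κ.  If π*(z) = 1 nothing changes; if
-- p(z) > p*(z) + κ both thresholds lie below p(z) and again nothing changes.
-- Otherwise 0 ≤ b(z) ≤ π(z) bounds the change by 4 β π(z), and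
-- π(z) < 2^(p*(z) + κ + 1) ≤ 2 · 2^κ · π*(z) = O(r) · (π*(z) − 1).
module Submission where

open import Defs
open import Data.Bool using (true; false; T; if_then_else_; _∧_; not)
open import Data.Empty using (⊥-elim)
open import Data.Fin using (Fin; _≟_)
open import Data.Integer as ℤ using (+_)
import Data.Integer.Properties as ℤP
open import Data.List using (List; []; _∷_; length; filter; foldr; map; allFin)
open import Data.List.Membership.Propositional using (_∈_)
import Data.List.Properties as ListP
open import Data.List.Relation.Binary.Permutation.Propositional using (_↭_; ↭-sym; ↭⇒↭ₛ)
import Data.List.Relation.Binary.Permutation.Setoid.Properties as PermSetoid
open import Data.List.Relation.Unary.All as All using (All; []; _∷_)
import Data.List.Relation.Unary.All.Properties as AllP
open import Data.List.Relation.Unary.AllPairs using ([]; _∷_)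
open import Data.List.Relation.Unary.Unique.Propositional using (Unique)
import Data.List.Relation.Unary.Unique.Propositional.Properties as UniqueP
open import Data.Nat as ℕ using (ℕ; zero; suc; z≤n; s≤s; _≤_; _≰_; _<_; _∸_; _^_; ⌊_/2⌋; ⌈_/2⌉)
import Data.Nat.Coprimality as Coprimality
open import Data.Nat.Induction using (<-wellFounded)
open import Data.Nat.Logarithm using (⌊log₂_⌋; ⌈log₂_⌉; ⌊log₂⌋-mono-≤; ⌈log₂⌉-mono-≤; ⌈log₂2^n⌉≡n)
open import Data.Nat.Logarithm.Core using (⌊log2⌋)
import Data.Nat.Properties as ℕP
open import Data.Nat.Tactic.RingSolver using (solve-∀)
open import Data.Product using (∃; _,_)
open import Data.Rational as ℚ using (ℚ; mkℚ; 0ℚ; _+_; _-_; _*_)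
import Data.Rational.Properties as ℚP
import Data.Rational.Solver as ℚSolver
import Data.Rational.Unnormalised as ℚᵘ
import Data.Rational.Unnormalised.Properties as ℚᵘP
open import Data.Unit using (tt)
open import Induction.WellFounded using (Acc; acc)
open import Relation.Binary.PropositionalEquality
open import Relation.Nullary using (Dec; yes; no; ¬?)
open import Relation.Nullary.Decidable using (⌊_⌋)

⌈n/2⌉≤1+⌊n/2⌋ : ∀ n → ⌈ n /2⌉ ≤ suc ⌊ n /2⌋
⌈n/2⌉≤1+⌊n/2⌋ zero = z≤n
⌈n/2⌉≤1+⌊n/2⌋ (suc zero) = s≤s z≤n
⌈n/2⌉≤1+⌊n/2⌋ (suc (suc n)) = s≤s (⌈n/2⌉≤1+⌊n/2⌋ n)

module _ where
  open ℕP.≤-Reasoning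

  n<2^suc⌊log2⌋ : ∀ n (rec : Acc _<_ n) → n < 2 ^ suc (⌊log2⌋ n rec)
  n<2^suc⌊log2⌋ zero _ = s≤s z≤n
  n<2^suc⌊log2⌋ (suc zero) _ = s≤s (s≤s z≤n)
  n<2^suc⌊log2⌋ n@(suc (suc k)) (acc rs) = begin-strict
    n                    ≡⟨ ℕP.⌊n/2⌋+⌈n/2⌉≡n n ⟨
    h ℕ.+ ⌈ n /2⌉        ≤⟨ ℕP.+-monoʳ-≤ h (⌈n/2⌉≤1+⌊n/2⌋ n) ⟩
    h ℕ.+ suc h          <⟨ ℕP.n<1+n _ ⟩
    suc (h ℕ.+ suc h)    ≡⟨ double h ⟩
    2 ℕ.* suc h          ≤⟨ ℕP.*-monoʳ-≤ 2 (n<2^suc⌊log2⌋ (suc ⌊ k /2⌋) _) ⟩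
    2 ^ suc (⌊log2⌋ n (acc rs)) ∎
    where
    h : ℕ
    h = ⌊ n /2⌋
    double : ∀ h → suc (h ℕ.+ suc h) ≡ 2 ℕ.* suc h
    double = solve-∀

  2^⌊log2⌋≤n : ∀ n (rec : Acc _<_ n) → 1 ≤ n → 2 ^ ⌊log2⌋ n rec ≤ n
  2^⌊log2⌋≤n (suc zero) _ _ = s≤s z≤n
  2^⌊log2⌋≤n n@(suc (suc k)) (acc rs) _ = begin
    2 ^ ⌊log2⌋ n (acc rs) ≤⟨ ℕP.*-monoʳ-≤ 2 (2^⌊log2⌋≤n (suc ⌊ k /2⌋) _ (s≤s z≤n)) ⟩
    2 ℕ.* h               ≡⟨ cong (h ℕ.+_) (ℕP.+-identityʳ h) ⟩
    h ℕ.+ h               ≤⟨ ℕP.+-monoʳ-≤ h (ℕP.⌊n/2⌋≤⌈n/2⌉ n) ⟩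
    h ℕ.+ ⌈ n /2⌉         ≡⟨ ℕP.⌊n/2⌋+⌈n/2⌉≡n n ⟩
    n                     ∎
    where
    h : ℕ
    h = ⌊ n /2⌋

n<2^suc⌊log₂n⌋ : ∀ n → n < 2 ^ suc ⌊log₂ n ⌋
n<2^suc⌊log₂n⌋ n = n<2^suc⌊log2⌋ n (<-wellFounded n)

2^⌊log₂n⌋≤n : ∀ {n} → 1 ≤ n → 2 ^ ⌊log₂ n ⌋ ≤ n
2^⌊log₂n⌋≤n {n} = 2^⌊log2⌋≤n n (<-wellFounded n)

2^⌈log₂n⌉≤2n : ∀ {n} → 1 ≤ n → 2 ^ ⌈log₂ n ⌉ ≤ 2 ℕ.* n
2^⌈log₂n⌉≤2n {n} 1≤n = begin
  2 ^ ⌈log₂ n ⌉                    ≤⟨ ℕP.^-monoʳ-≤ 2 ⌈log₂n⌉≤1+⌊log₂n⌋ ⟩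
  2 ^ suc ⌊log₂ n ⌋                ≤⟨ ℕP.*-monoʳ-≤ 2 (2^⌊log₂n⌋≤n 1≤n) ⟩
  2 ℕ.* n                          ∎
  where
  open ℕP.≤-Reasoning
  ⌈log₂n⌉≤1+⌊log₂n⌋ : ⌈log₂ n ⌉ ≤ suc ⌊log₂ n ⌋
  ⌈log₂n⌉≤1+⌊log₂n⌋ = begin
    ⌈log₂ n ⌉                     ≤⟨ ⌈log₂⌉-mono-≤ (ℕP.<⇒≤ (n<2^suc⌊log₂n⌋ n)) ⟩
    ⌈log₂ (2 ^ suc ⌊log₂ n ⌋) ⌉   ≡⟨ ⌈log₂2^n⌉≡n (suc ⌊log₂ n ⌋) ⟩
    suc ⌊log₂ n ⌋                 ∎

⟦⟧≡mkℚ : ∀ m → ⟦ m ⟧ ≡ mkℚ (+ m) 0 (Coprimality.sym (Coprimality.1-coprimeTo m))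
⟦⟧≡mkℚ m = ℚP.normalize-coprime (Coprimality.sym (Coprimality.1-coprimeTo m))

⟦⟧-homo-+ : ∀ m n → ⟦ m ℕ.+ n ⟧ ≡ ⟦ m ⟧ + ⟦ n ⟧
⟦⟧-homo-+ m n = sym (trans (cong₂ _+_ (⟦⟧≡mkℚ m) (⟦⟧≡mkℚ n))
  (ℚP./-cong (cong₂ ℤ._+_ (ℤP.*-identityʳ (+ m)) (ℤP.*-identityʳ (+ n))) refl))

⟦⟧-homo-* : ∀ m n → ⟦ m ℕ.* n ⟧ ≡ ⟦ m ⟧ * ⟦ n ⟧
⟦⟧-homo-* m n = sym (trans (cong₂ _*_ (⟦⟧≡mkℚ m) (⟦⟧≡mkℚ n)) (ℚP./-cong (sym (ℤP.pos-* m n)) refl))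

⟦⟧-mono-≤ : ∀ {m n} → m ≤ n → ⟦ m ⟧ ℚ.≤ ⟦ n ⟧
⟦⟧-mono-≤ {m} {n} m≤n rewrite ⟦⟧≡mkℚ m | ⟦⟧≡mkℚ n = ℚ.*≤* (ℤP.*-monoʳ-≤-nonNeg (+ 1) (ℤ.+≤+ m≤n))

0≤⟦⟧ : ∀ m → 0ℚ ℚ.≤ ⟦ m ⟧
0≤⟦⟧ m = ⟦⟧-mono-≤ {0} {m} z≤n

⟦2⟧*[k/2]≡⟦k⟧ : ∀ k → ⟦ 2 ⟧ * ((+ k) ℚ./ 2) ≡ ⟦ k ⟧
⟦2⟧*[k/2]≡⟦k⟧ k = ℚP.toℚᵘ-injective (begin
  ℚ.toℚᵘ (⟦ 2 ⟧ * ((+ k) ℚ./ 2))                ≈⟨ ℚP.toℚᵘ-homo-* ⟦ 2 ⟧ ((+ k) ℚ./ 2) ⟩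
  ℚ.toℚᵘ ⟦ 2 ⟧ ℚᵘ.* ℚ.toℚᵘ ((+ k) ℚ./ 2)         ≈⟨ ℚᵘP.*-cong (ℚP.toℚᵘ-fromℚᵘ (ℚᵘ.mkℚᵘ (+ 2) 0))
                                                                (ℚP.toℚᵘ-fromℚᵘ (ℚᵘ.mkℚᵘ (+ k) 1)) ⟩
  ℚᵘ.mkℚᵘ (+ 2) 0 ℚᵘ.* ℚᵘ.mkℚᵘ (+ k) 1          ≈⟨ ℚᵘ.*≡* (trans (ℤP.*-identityʳ _) (ℤP.*-comm (+ 2) (+ k))) ⟩
  ℚᵘ.mkℚᵘ (+ k) 0                               ≈⟨ ℚP.toℚᵘ-fromℚᵘ (ℚᵘ.mkℚᵘ (+ k) 0) ⟨
  ℚ.toℚᵘ ⟦ k ⟧                                  ∎)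
  where open ℚᵘP.≃-Reasoning

2β≡⟦15r+10⟧ : ∀ r → ⟦ 2 ⟧ * βc r ≡ ⟦ 15 ℕ.* r ℕ.+ 10 ⟧
2β≡⟦15r+10⟧ r = begin
  ⟦ 2 ⟧ * ((+ (15 ℕ.* r)) ℚ./ 2 + ⟦ 5 ⟧)           ≡⟨ ℚP.*-distribˡ-+ ⟦ 2 ⟧ ((+ (15 ℕ.* r)) ℚ./ 2) ⟦ 5 ⟧ ⟩
  ⟦ 2 ⟧ * ((+ (15 ℕ.* r)) ℚ./ 2) + ⟦ 2 ⟧ * ⟦ 5 ⟧  ≡⟨ cong₂ _+_ (⟦2⟧*[k/2]≡⟦k⟧ (15 ℕ.* r)) (sym (⟦⟧-homo-* 2 5)) ⟩
  ⟦ 15 ℕ.* r ⟧ + ⟦ 10 ⟧                          ≡⟨ ⟦⟧-homo-+ (15 ℕ.* r) 10 ⟨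
  ⟦ 15 ℕ.* r ℕ.+ 10 ⟧                            ∎
  where open ≡-Reasoning

0≤α+γ : ∀ r → 0ℚ ℚ.≤ αc + γc r
0≤α+γ r = ℚP.≤-trans (0≤⟦⟧ (2 ℕ.+ 5 ℕ.* r)) (ℚP.≤-reflexive (⟦⟧-homo-+ 2 (5 ℕ.* r)))

α+γ≤β : ∀ r → αc + γc r ℚ.≤ βc r
α+γ≤β r = ℚP.*-cancelˡ-≤-pos ⟦ 2 ⟧ (begin
  ⟦ 2 ⟧ * (αc + γc r)           ≡⟨ trans (⟦⟧-homo-* 2 (2 ℕ.+ 5 ℕ.* r)) (cong (⟦ 2 ⟧ *_) (⟦⟧-homo-+ 2 (5 ℕ.* r))) ⟨
  ⟦ 2 ℕ.* (2 ℕ.+ 5 ℕ.* r) ⟧    ≤⟨ ⟦⟧-mono-≤ 2[2+5r]≤15r+10 ⟩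
  ⟦ 15 ℕ.* r ℕ.+ 10 ⟧           ≡⟨ 2β≡⟦15r+10⟧ r ⟨
  ⟦ 2 ⟧ * βc r                   ∎)
  where
  open ℚP.≤-Reasoning
  2[2+5r]≤15r+10 : 2 ℕ.* (2 ℕ.+ 5 ℕ.* r) ≤ 15 ℕ.* r ℕ.+ 10
  2[2+5r]≤15r+10 = ℕP.≤-trans (ℕP.≤-reflexive (expand r))
    (ℕP.+-mono-≤ (ℕP.*-monoˡ-≤ r (ℕP.m≤m+n 10 5)) (ℕP.m≤m+n 4 6))
    where
    expand : ∀ r → 2 ℕ.* (2 ℕ.+ 5 ℕ.* r) ≡ 10 ℕ.* r ℕ.+ 4
    expand = solve-∀

0≤p*q : ∀ {p q} → 0ℚ ℚ.≤ p → 0ℚ ℚ.≤ q → 0ℚ ℚ.≤ p * q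
0≤p*q {p} {q} 0≤p 0≤q = ℚP.≤-trans (ℚP.≤-reflexive (sym (ℚP.*-zeroʳ p)))
  (ℚP.*-monoˡ-≤-nonNeg p {{ℚ.nonNegative 0≤p}} 0≤q)

p-q≤r : ∀ {p q r} → 0ℚ ℚ.≤ q → p ℚ.≤ r → p - q ℚ.≤ r
p-q≤r {p} {q} {r} 0≤q p≤r = begin
  p - q   ≤⟨ ℚP.+-monoʳ-≤ p (ℚP.neg-antimono-≤ 0≤q) ⟩
  p + 0ℚ  ≡⟨ ℚP.+-identityʳ p ⟩
  p       ≤⟨ p≤r ⟩
  r       ∎
  where open ℚP.≤-Reasoning

p≤q⇒p-q≤0 : ∀ {p q} → p ℚ.≤ q → p - q ℚ.≤ 0ℚ
p≤q⇒p-q≤0 {p} {q} p≤q = ℚP.≤-trans (ℚP.+-monoˡ-≤ (ℚ.- q) p≤q) (ℚP.≤-reflexive (ℚP.+-inverseʳ q))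

if-antitone : ∀ {c c'} {x y : ℚ} → (T c → T c') → x ℚ.≤ y →
              (if c' then x else y) ℚ.≤ (if c then x else y)
if-antitone {true}  {true}  _ _   = ℚP.≤-refl
if-antitone {true}  {false} c⇒c' _ = ⊥-elim (c⇒c' tt)
if-antitone {false} {true}  _ x≤y = x≤y
if-antitone {false} {false} _ _   = ℚP.≤-refl

-- Φz r S L w and Ψz r S L w are Φ-at and Ψ-at at π = π(w), b = b(w) and the threshold t = p*(w) + κ.
Φ-at : (r π : ℕ) → ℚ → ℕ → ℚ
Φ-at r π b t = if pexp π ℕ.≤ᵇ t then αc * b else βc r * ⟦ π ⟧ - γc r * b

Ψ-at : (r π t : ℕ) → ℚ
Ψ-at r π t = if pexp π ℕ.<ᵇ t then 0ℚ else ⟦ 2 ⟧ * βc r * ⟦ qrem π ⟧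

αb≤βπ-γb : ∀ r π {b} → b ℚ.≤ ⟦ π ⟧ → αc * b ℚ.≤ βc r * ⟦ π ⟧ - γc r * b
αb≤βπ-γb r π {b} b≤π = begin
  αc * b                      ≡⟨ solve 3 (λ a g b → a :* b := (a :+ g) :* b :- g :* b) refl αc (γc r) b ⟩
  (αc + γc r) * b - γc r * b  ≤⟨ ℚP.+-monoˡ-≤ (ℚ.- (γc r * b)) (ℚP.≤-trans
                                    (ℚP.*-monoˡ-≤-nonNeg (αc + γc r) {{ℚ.nonNegative (0≤α+γ r)}} b≤π)
                                    (ℚP.*-monoʳ-≤-nonNeg ⟦ π ⟧ {{ℚ.nonNegative (0≤⟦⟧ π)}} (α+γ≤β r))) ⟩
  βc r * ⟦ π ⟧ - γc r * b     ∎
  where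
  open ℚP.≤-Reasoning
  open ℚSolver.+-*-Solver using (solve; _:=_; _:+_; _:*_; _:-_)

0≤2β : ∀ r → 0ℚ ℚ.≤ ⟦ 2 ⟧ * βc r
0≤2β r = ℚP.≤-trans (0≤⟦⟧ (15 ℕ.* r ℕ.+ 10)) (ℚP.≤-reflexive (sym (2β≡⟦15r+10⟧ r)))

0≤βπ : ∀ r π → 0ℚ ℚ.≤ βc r * ⟦ π ⟧
0≤βπ r π = 0≤p*q (ℚP.≤-trans (0≤α+γ r) (α+γ≤β r)) (0≤⟦⟧ π)

βπ≤2βπ : ∀ r π → βc r * ⟦ π ⟧ ℚ.≤ ⟦ 2 ⟧ * βc r * ⟦ π ⟧
βπ≤2βπ r π = begin
  βc r * ⟦ π ⟧                    ≡⟨ ℚP.+-identityʳ (βc r * ⟦ π ⟧) ⟨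
  βc r * ⟦ π ⟧ + 0ℚ               ≤⟨ ℚP.+-monoʳ-≤ (βc r * ⟦ π ⟧) (0≤βπ r π) ⟩
  βc r * ⟦ π ⟧ + βc r * ⟦ π ⟧     ≡⟨ solve 2 (λ b p → b :* p :+ b :* p := con ⟦ 2 ⟧ :* b :* p) refl (βc r) ⟦ π ⟧ ⟩
  ⟦ 2 ⟧ * βc r * ⟦ π ⟧            ∎
  where
  open ℚP.≤-Reasoning
  open ℚSolver.+-*-Solver using (solve; _:=_; _:+_; _:*_; con)

Φ-at-antitone : ∀ r π {b t t'} → b ℚ.≤ ⟦ π ⟧ → t ≤ t' → Φ-at r π b t' ℚ.≤ Φ-at r π b t
Φ-at-antitone r π {t = t} b≤π t≤t' =
  if-antitone (λ p≤t → ℕP.≤⇒≤ᵇ (ℕP.≤-trans (ℕP.≤ᵇ⇒≤ (pexp π) t p≤t) t≤t')) (αb≤βπ-γb r π b≤π)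

Ψ-at-antitone : ∀ r π {t t'} → t ≤ t' → Ψ-at r π t' ℚ.≤ Ψ-at r π t
Ψ-at-antitone r π {t} t≤t' =
  if-antitone (λ p<t → ℕP.<⇒<ᵇ (ℕP.<-≤-trans (ℕP.<ᵇ⇒< (pexp π) t p<t) t≤t')) (0≤p*q (0≤2β r) (0≤⟦⟧ (qrem π)))

0≤Φ-at : ∀ r π {b} t → 0ℚ ℚ.≤ b → b ℚ.≤ ⟦ π ⟧ → 0ℚ ℚ.≤ Φ-at r π b t
0≤Φ-at r π t 0≤b b≤π with pexp π ℕ.≤ᵇ t
... | true  = 0≤p*q (0≤⟦⟧ 2) 0≤b
... | false = ℚP.≤-trans (0≤p*q (0≤⟦⟧ 2) 0≤b) (αb≤βπ-γb r π b≤π)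

Φ-at≤2βπ : ∀ r π {b} t → 0ℚ ℚ.≤ b → b ℚ.≤ ⟦ π ⟧ → Φ-at r π b t ℚ.≤ ⟦ 2 ⟧ * βc r * ⟦ π ⟧
Φ-at≤2βπ r π {b} t 0≤b b≤π = ℚP.≤-trans Φ-at≤βπ (βπ≤2βπ r π)
  where
  βπ-γb≤βπ : βc r * ⟦ π ⟧ - γc r * b ℚ.≤ βc r * ⟦ π ⟧
  βπ-γb≤βπ = p-q≤r (0≤p*q (0≤⟦⟧ (5 ℕ.* r)) 0≤b) ℚP.≤-refl
  Φ-at≤βπ : Φ-at r π b t ℚ.≤ βc r * ⟦ π ⟧
  Φ-at≤βπ with pexp π ℕ.≤ᵇ t
  ... | true  = ℚP.≤-trans (αb≤βπ-γb r π b≤π) βπ-γb≤βπ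
  ... | false = βπ-γb≤βπ

0≤Ψ-at : ∀ r π t → 0ℚ ℚ.≤ Ψ-at r π t
0≤Ψ-at r π t with pexp π ℕ.<ᵇ t
... | true  = ℚP.≤-refl
... | false = 0≤p*q (0≤2β r) (0≤⟦⟧ (qrem π))

Ψ-at≤2βπ : ∀ r π t → Ψ-at r π t ℚ.≤ ⟦ 2 ⟧ * βc r * ⟦ π ⟧
Ψ-at≤2βπ r π t with pexp π ℕ.<ᵇ t
... | true  = 0≤p*q (0≤2β r) (0≤⟦⟧ π)
... | false = ℚP.*-monoˡ-≤-nonNeg (⟦ 2 ⟧ * βc r) {{ℚ.nonNegative (0≤2β r)}}
                (⟦⟧-mono-≤ (ℕP.m∸n≤m π (2 ^ pexp π)))

Φ-at-above : ∀ r π {b t} → t < pexp π → Φ-at r π b t ≡ βc r * ⟦ π ⟧ - γc r * b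
Φ-at-above r π {t = t} t<p with pexp π ℕ.≤ᵇ t | ℕP.≤ᵇ⇒≤ (pexp π) t
... | true  | p≤t = ⊥-elim (ℕP.<⇒≱ t<p (p≤t tt))
... | false | _   = refl

Ψ-at-above : ∀ r π {t} → t < pexp π → Ψ-at r π t ≡ ⟦ 2 ⟧ * βc r * ⟦ qrem π ⟧
Ψ-at-above r π {t} t<p with pexp π ℕ.<ᵇ t | ℕP.<ᵇ⇒< (pexp π) t
... | true  | p<t = ⊥-elim (ℕP.<-asym t<p (p<t tt))
... | false | _   = refl

Δ-at : (r π : ℕ) → ℚ → (t t' : ℕ) → ℚ
Δ-at r π b t t' = (Φ-at r π b t' - Φ-at r π b t) + (Ψ-at r π t' - Ψ-at r π t)

Δ-at≤0 : ∀ r π {b t t'} → b ℚ.≤ ⟦ π ⟧ → t ≤ t' → Δ-at r π b t t' ℚ.≤ 0ℚ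
Δ-at≤0 r π b≤π t≤t' = ℚP.≤-trans
  (ℚP.+-mono-≤ (p≤q⇒p-q≤0 (Φ-at-antitone r π b≤π t≤t')) (p≤q⇒p-q≤0 (Ψ-at-antitone r π t≤t')))
  (ℚP.≤-reflexive (ℚP.+-identityʳ 0ℚ))

Δ-at≤4βπ : ∀ r π {b} t t' → 0ℚ ℚ.≤ b → b ℚ.≤ ⟦ π ⟧ →
           Δ-at r π b t t' ℚ.≤ ⟦ 2 ⟧ * βc r * ⟦ π ⟧ + ⟦ 2 ⟧ * βc r * ⟦ π ⟧
Δ-at≤4βπ r π t t' 0≤b b≤π = ℚP.+-mono-≤
  (p-q≤r (0≤Φ-at r π t 0≤b b≤π) (Φ-at≤2βπ r π t' 0≤b b≤π))
  (p-q≤r (0≤Ψ-at r π t) (Ψ-at≤2βπ r π t'))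

Δ-at-above : ∀ r π {b t t'} → t < pexp π → t' < pexp π → Δ-at r π b t t' ≡ 0ℚ
Δ-at-above r π {b} {t} {t'} t<p t'<p = begin
  (Φ-at r π b t' - Φ-at r π b t) + (Ψ-at r π t' - Ψ-at r π t)
    ≡⟨ cong₂ _+_ (cong₂ _-_ (Φ-at-above r π t'<p) (Φ-at-above r π t<p))
                 (cong₂ _-_ (Ψ-at-above r π t'<p) (Ψ-at-above r π t<p)) ⟩
  (φ - φ) + (ψ - ψ)   ≡⟨ cong₂ _+_ (ℚP.+-inverseʳ φ) (ℚP.+-inverseʳ ψ) ⟩
  0ℚ + 0ℚ             ≡⟨ ℚP.+-identityʳ 0ℚ ⟩
  0ℚ                  ∎
  where
  open ≡-Reasoning
  φ ψ : ℚ
  φ = βc r * ⟦ π ⟧ - γc r * b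
  ψ = ⟦ 2 ⟧ * βc r * ⟦ qrem π ⟧

2^κ≤150r : ∀ {r} → 1 ≤ r → 2 ^ κc r ≤ 150 ℕ.* r
2^κ≤150r {r} 1≤r = begin
  2 ^ κc r                       ≤⟨ 2^⌈log₂n⌉≤2n (ℕP.≤-trans (s≤s z≤n) (ℕP.m≤n+m 30 (45 ℕ.* r))) ⟩
  2 ℕ.* (45 ℕ.* r ℕ.+ 30)        ≤⟨ ℕP.*-monoʳ-≤ 2 (ℕP.+-monoʳ-≤ (45 ℕ.* r) (ℕP.*-monoʳ-≤ 30 1≤r)) ⟩
  2 ℕ.* (45 ℕ.* r ℕ.+ 30 ℕ.* r)  ≡⟨ collect r ⟩
  150 ℕ.* r                      ∎
  where
  open ℕP.≤-Reasoning
  collect : ∀ r → 2 ℕ.* (45 ℕ.* r ℕ.+ 30 ℕ.* r) ≡ 150 ℕ.* r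
  collect = solve-∀

π≤300ra : ∀ {r π a} → 1 ≤ r → 1 ≤ a → pexp π ≤ pexp a ℕ.+ κc r → π ≤ 300 ℕ.* r ℕ.* a
π≤300ra {r} {π} {a} 1≤r 1≤a p≤p*+κ = begin
  π                                    ≤⟨ ℕP.<⇒≤ (n<2^suc⌊log₂n⌋ π) ⟩
  2 ^ suc (pexp π)                     ≤⟨ ℕP.^-monoʳ-≤ 2 (s≤s p≤p*+κ) ⟩
  2 ℕ.* 2 ^ (pexp a ℕ.+ κc r)          ≡⟨ cong (2 ℕ.*_) (ℕP.^-distribˡ-+-* 2 (pexp a) (κc r)) ⟩
  2 ℕ.* (2 ^ pexp a ℕ.* 2 ^ κc r)      ≤⟨ ℕP.*-monoʳ-≤ 2 (ℕP.*-mono-≤ (2^⌊log₂n⌋≤n 1≤a) (2^κ≤150r 1≤r)) ⟩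
  2 ℕ.* (a ℕ.* (150 ℕ.* r))            ≡⟨ rearrange r a ⟩
  300 ℕ.* r ℕ.* a                      ∎
  where
  open ℕP.≤-Reasoning
  rearrange : ∀ r a → 2 ℕ.* (a ℕ.* (150 ℕ.* r)) ≡ 300 ℕ.* r ℕ.* a
  rearrange = solve-∀

a≤2[a∸1] : ∀ {a} → 2 ≤ a → a ≤ 2 ℕ.* (a ∸ 1)
a≤2[a∸1] {suc zero} (s≤s ())
a≤2[a∸1] {suc (suc k)} _ = ℕP.≤-trans (ℕP.m≤m+n (suc (suc k)) k) (ℕP.≤-reflexive (regroup k))
  where
  regroup : ∀ k → suc (suc k) ℕ.+ k ≡ 2 ℕ.* suc k
  regroup = solve-∀

2Mπ≤Cr²[a∸1] : ∀ {r π a} → 1 ≤ r → 2 ≤ a → π ≤ 300 ℕ.* r ℕ.* a →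
  let M = 15 ℕ.* r ℕ.+ 10 in M ℕ.* π ℕ.+ M ℕ.* π ≤ 30000 ℕ.* r ^ 2 ℕ.* (a ∸ 1)
2Mπ≤Cr²[a∸1] {r} {π} {a} 1≤r 2≤a π≤ = begin
  M ℕ.* π ℕ.+ M ℕ.* π                        ≡⟨ double (M ℕ.* π) ⟩
  2 ℕ.* (M ℕ.* π)                            ≤⟨ ℕP.*-monoʳ-≤ 2 (ℕP.*-mono-≤ M≤25r π≤) ⟩
  2 ℕ.* (25 ℕ.* r ℕ.* (300 ℕ.* r ℕ.* a))     ≡⟨ collect r a ⟩
  15000 ℕ.* (r ℕ.* r) ℕ.* a                  ≤⟨ ℕP.*-monoʳ-≤ (15000 ℕ.* (r ℕ.* r)) (a≤2[a∸1] 2≤a) ⟩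
  15000 ℕ.* (r ℕ.* r) ℕ.* (2 ℕ.* (a ∸ 1))    ≡⟨ halve r (a ∸ 1) ⟩
  30000 ℕ.* (r ℕ.* r) ℕ.* (a ∸ 1)            ≡⟨ cong (λ x → 30000 ℕ.* (r ℕ.* x) ℕ.* (a ∸ 1)) (ℕP.*-identityʳ r) ⟨
  30000 ℕ.* r ^ 2 ℕ.* (a ∸ 1)                ∎
  where
  open ℕP.≤-Reasoning
  M : ℕ
  M = 15 ℕ.* r ℕ.+ 10
  M≤25r : M ≤ 25 ℕ.* r
  M≤25r = ℕP.≤-trans (ℕP.+-monoʳ-≤ (15 ℕ.* r) (ℕP.*-monoʳ-≤ 10 1≤r)) (ℕP.≤-reflexive (merge r))
    where
    merge : ∀ r → 15 ℕ.* r ℕ.+ 10 ℕ.* r ≡ 25 ℕ.* r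
    merge = solve-∀
  double : ∀ x → x ℕ.+ x ≡ 2 ℕ.* x
  double = solve-∀
  collect : ∀ r a → 2 ℕ.* (25 ℕ.* r ℕ.* (300 ℕ.* r ℕ.* a)) ≡ 15000 ℕ.* (r ℕ.* r) ℕ.* a
  collect = solve-∀
  halve : ∀ r m → 15000 ℕ.* (r ℕ.* r) ℕ.* (2 ℕ.* m) ≡ 30000 ℕ.* (r ℕ.* r) ℕ.* m
  halve = solve-∀

-- r, π and a ∸ 1 are given explicitly and kept unreduced from here on: if
-- unification has to compare ⟦ 30000 ℕ.* r ^ 2 ⟧ * ⟦ _ ⟧ up to reduction, it
-- unfolds the unary product 30000 ℕ.* _ and runs out of memory.
4βπ≤Cr²[a∸1] : ∀ r π {a} → 1 ≤ r → 2 ≤ a → pexp π ≤ pexp a ℕ.+ κc r →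
  ⟦ 2 ⟧ * βc r * ⟦ π ⟧ + ⟦ 2 ⟧ * βc r * ⟦ π ⟧ ℚ.≤ ⟦ 30000 ℕ.* r ^ 2 ⟧ * ⟦ a ∸ 1 ⟧
4βπ≤Cr²[a∸1] r π {a} 1≤r 2≤a p≤p*+κ = begin
  ⟦ 2 ⟧ * βc r * ⟦ π ⟧ + ⟦ 2 ⟧ * βc r * ⟦ π ⟧
    ≡⟨ cong (λ x → x * ⟦ π ⟧ + x * ⟦ π ⟧) (2β≡⟦15r+10⟧ r) ⟩
  ⟦ M ⟧ * ⟦ π ⟧ + ⟦ M ⟧ * ⟦ π ⟧
    ≡⟨ trans (⟦⟧-homo-+ (M ℕ.* π) (M ℕ.* π)) (cong₂ _+_ (⟦⟧-homo-* M π) (⟦⟧-homo-* M π)) ⟨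
  ⟦ M ℕ.* π ℕ.+ M ℕ.* π ⟧
    ≤⟨ ⟦⟧-mono-≤ (2Mπ≤Cr²[a∸1] 1≤r 2≤a (π≤300ra 1≤r (ℕP.≤-trans (s≤s z≤n) 2≤a) p≤p*+κ)) ⟩
  ⟦ 30000 ℕ.* r ^ 2 ℕ.* (a ∸ 1) ⟧
    ≡⟨ ⟦⟧-homo-* (30000 ℕ.* r ^ 2) (a ∸ 1) ⟩
  ⟦ 30000 ℕ.* r ^ 2 ⟧ * ⟦ a ∸ 1 ⟧ ∎
  where
  open ℚP.≤-Reasoning
  M : ℕ
  M = 15 ℕ.* r ℕ.+ 10

pexp≡0 : ∀ {a} → 2 ≰ a → pexp a ≡ 0
pexp≡0 {zero}        _   = refl
pexp≡0 {suc zero}    _   = refl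
pexp≡0 {suc (suc _)} 2≰a = ⊥-elim (2≰a (s≤s (s≤s z≤n)))

Δ-at-front≤ : ∀ r π {b} a → 1 ≤ r → 0ℚ ℚ.≤ b → b ℚ.≤ ⟦ π ⟧ →
  Δ-at r π b (pexp a ℕ.+ κc r) (κc r) ℚ.≤ ⟦ 30000 ℕ.* r ^ 2 ⟧ * ⟦ a ∸ 1 ⟧
Δ-at-front≤ r π {b} a 1≤r 0≤b b≤π = by-cases (2 ℕ.≤? a) (pexp π ℕ.≤? t)
  where
  t : ℕ
  t = pexp a ℕ.+ κc r
  Cr²[a∸1] : ℚ
  Cr²[a∸1] = ⟦ 30000 ℕ.* r ^ 2 ⟧ * ⟦ a ∸ 1 ⟧
  0≤Cr²[a∸1] : 0ℚ ℚ.≤ Cr²[a∸1]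
  0≤Cr²[a∸1] = 0≤p*q (0≤⟦⟧ (30000 ℕ.* r ^ 2)) (0≤⟦⟧ (a ∸ 1))
  by-cases : Dec (2 ≤ a) → Dec (pexp π ≤ t) → Δ-at r π b t (κc r) ℚ.≤ Cr²[a∸1]
  by-cases (no 2≰a) _ =
    ℚP.≤-trans (Δ-at≤0 r π b≤π (ℕP.≤-reflexive (cong (ℕ._+ κc r) (pexp≡0 2≰a)))) 0≤Cr²[a∸1]
  by-cases (yes 2≤a) (yes p≤t) =
    ℚP.≤-trans (Δ-at≤4βπ r π t (κc r) 0≤b b≤π) (4βπ≤Cr²[a∸1] r π 1≤r 2≤a p≤t)
  by-cases (yes _) (no p≰t) =
    ℚP.≤-trans (ℚP.≤-reflexive (Δ-at-above r π t<p κ<p)) 0≤Cr²[a∸1]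
    where
    t<p : t < pexp π
    t<p = ℕP.≰⇒> p≰t
    κ<p : κc r < pexp π
    κ<p = ℕP.≤-<-trans (ℕP.m≤n+m (κc r) (pexp a)) t<p

module _ {n : ℕ} where

  moveToFront-unique : ∀ (z : Fin n) {L} → Unique L → Unique (moveToFront z L)
  moveToFront-unique z {L} uL =
    All.map (λ w≢z z≡w → w≢z (sym z≡w)) (AllP.all-filter (λ w → ¬? (w ≟ z)) L)
    ∷ UniqueP.filter⁺ (λ w → ¬? (w ≟ z)) uL

  Reachable-unique : ∀ {r L₀ S L} → L₀ ↭ allFin n → Reachable {n} r L₀ S L → Unique L
  Reachable-unique L₀↭allFin start =
    PermSetoid.Unique-resp-↭ (setoid (Fin n)) (↭⇒↭ₛ (↭-sym L₀↭allFin)) (UniqueP.allFin⁺ n)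
  Reachable-unique L₀↭allFin (next {z = z} reach _ _ _) =
    moveToFront-unique z (Reachable-unique L₀↭allFin reach)

  pos-moveToFront-self : ∀ (z : Fin n) L → pos (moveToFront z L) z ≡ 1
  pos-moveToFront-self z L with z ≟ z
  ... | yes _ = refl
  ... | no z≢z = ⊥-elim (z≢z refl)

  pos≤pos-moveToFront : ∀ (z : Fin n) {w} L → Unique L → w ≢ z → pos L w ≤ pos (moveToFront z L) w
  pos≤pos-moveToFront z {w} L uL w≢z with z ≟ w
  ... | yes z≡w = ⊥-elim (w≢z (sym z≡w))
  ... | no _ = pos≤1+pos-filter L uL
    where
    pos≤1+pos-filter : ∀ L → Unique L → pos L w ≤ suc (pos (filter (λ y → ¬? (y ≟ z)) L) w)
    pos≤1+pos-filter [] _ = z≤n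
    pos≤1+pos-filter (x ∷ xs) (x∉xs ∷ uxs) with x ≟ z
    ... | yes refl with x ≟ w
    ...   | yes x≡w = ⊥-elim (w≢z (sym x≡w))
    ...   | no _ = s≤s (ℕP.≤-reflexive (cong (λ l → pos l w)
             (sym (ListP.filter-all (λ y → ¬? (y ≟ x)) (All.map (λ x≢y y≡x → x≢y (sym y≡x)) x∉xs)))))
    pos≤1+pos-filter (x ∷ xs) (_ ∷ uxs) | no _ with x ≟ w
    ...   | yes _ = s≤s z≤n
    ...   | no _ = s≤s (pos≤1+pos-filter xs uxs)

module _ {n : ℕ} where

  NonNegBudgets : DLMState n → Set
  NonNegBudgets S = ∀ w → 0ℚ ℚ.≤ budget S w

  fetch-nonNeg : ∀ z S → NonNegBudgets S → NonNegBudgets (fetch z S)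
  fetch-nonNeg z _ 0≤b w with w ≟ z
  ... | yes _ = ℚP.≤-refl
  ... | no _  = 0≤b w

  0≤share : ∀ ℓ (R : List (Fin n)) → 0ℚ ℚ.≤ share ℓ R
  0≤share ℓ [] = ℚP.≤-refl
  0≤share ℓ (_ ∷ R) = ℚP.nonNegative⁻¹ _ {{ℚP.normalize-nonNeg ℓ (suc (length R))}}

  addBudgets-nonNeg : ∀ R x {δ} S → 0ℚ ℚ.≤ δ → NonNegBudgets S → NonNegBudgets (addBudgets R x δ S)
  addBudgets-nonNeg R x _ 0≤δ 0≤b w with (w ∈ᵇ R) ∧ not ⌊ w ≟ x ⌋
  ... | true  = ℚP.≤-trans (ℚP.≤-reflexive (sym (ℚP.+-identityʳ 0ℚ))) (ℚP.+-mono-≤ (0≤b w) 0≤δ)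
  ... | false = 0≤b w

  Cleanup-nonNeg : ∀ {S S'} → Cleanup S S' → NonNegBudgets S → NonNegBudgets S'
  Cleanup-nonNeg (done _) 0≤b = 0≤b
  Cleanup-nonNeg {S} (step z _ c) 0≤b = Cleanup-nonNeg c (fetch-nonNeg z S 0≤b)

  DLMStep-nonNeg : ∀ {R S S'} → DLMStep R S S' → NonNegBudgets S → NonNegBudgets S'
  DLMStep-nonNeg {R} {S} (dlm x _ _ c) 0≤b =
    Cleanup-nonNeg c (addBudgets-nonNeg R x (fetch x S) (0≤share (pos (list S) x) R) (fetch-nonNeg x S 0≤b))

  Reachable-nonNeg : ∀ {r L₀ S L} → Reachable {n} r L₀ S L → NonNegBudgets S
  Reachable-nonNeg start _ = ℚP.≤-refl {0ℚ}
  Reachable-nonNeg (next reach _ dlmStep _) = DLMStep-nonNeg dlmStep (Reachable-nonNeg reach)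

  Cleanup-budget<pos : ∀ {S S' : DLMState n} → Cleanup S S' → ∀ w → budget S' w ℚ.< ⟦ pos (list S') w ⟧
  Cleanup-budget<pos (done b<π) = b<π
  Cleanup-budget<pos (step _ _ c) = Cleanup-budget<pos c

  DLMStep-budget<pos : ∀ {R S S'} → DLMStep R S S' → ∀ w → budget S' w ℚ.< ⟦ pos (list S') w ⟧
  DLMStep-budget<pos (dlm _ _ _ c) = Cleanup-budget<pos c

module _ {n : ℕ} where

  sumOver : (Fin n → ℚ) → List (Fin n) → ℚ
  sumOver f xs = foldr _+_ 0ℚ (map f xs)

  sumOver-differences : ∀ (f' f g' g : Fin n → ℚ) xs →
    (sumOver f' xs - sumOver f xs) + (sumOver g' xs - sumOver g xs) ≡
    sumOver (λ w → (f' w - f w) + (g' w - g w)) xs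
  sumOver-differences f' f g' g [] = trans (cong₂ _+_ (ℚP.+-inverseʳ 0ℚ) (ℚP.+-inverseʳ 0ℚ)) (ℚP.+-identityʳ 0ℚ)
  sumOver-differences f' f g' g (x ∷ xs) = trans
    (solve 8 (λ a' A' a A c' C' c C →
               (a' :+ A') :- (a :+ A) :+ ((c' :+ C') :- (c :+ C)) := ((a' :- a) :+ (c' :- c)) :+ ((A' :- A) :+ (C' :- C)))
           refl (f' x) (sumOver f' xs) (f x) (sumOver f xs) (g' x) (sumOver g' xs) (g x) (sumOver g xs))
    (cong (_+_ ((f' x - f x) + (g' x - g x))) (sumOver-differences f' f g' g xs))
    where open ℚSolver.+-*-Solver using (solve; _:=_; _:+_; _:-_)

  sumOver-nonPos : ∀ h {xs} → All (λ w → h w ℚ.≤ 0ℚ) xs → sumOver h xs ℚ.≤ 0ℚ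
  sumOver-nonPos h [] = ℚP.≤-refl
  sumOver-nonPos h (hx≤0 ∷ hxs≤0) =
    ℚP.≤-trans (ℚP.+-mono-≤ hx≤0 (sumOver-nonPos h hxs≤0)) (ℚP.≤-reflexive (ℚP.+-identityʳ 0ℚ))

  sumOver-≤-peak : ∀ (z : Fin n) h xs {B} → Unique xs →
    (∀ w → w ≢ z → h w ℚ.≤ 0ℚ) → h z ℚ.≤ B → 0ℚ ℚ.≤ B → sumOver h xs ℚ.≤ B
  sumOver-≤-peak z h [] _ _ _ 0≤B = 0≤B
  sumOver-≤-peak z h (x ∷ xs) {B} (x∉xs ∷ uxs) h≤0 hz≤B 0≤B with x ≟ z
  ... | yes refl = ℚP.≤-trans (ℚP.+-mono-≤ hz≤B (sumOver-nonPos h (All.map (λ x≢w → h≤0 _ (≢-sym x≢w)) x∉xs)))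
                              (ℚP.≤-reflexive (ℚP.+-identityʳ B))
  ... | no x≢z = ℚP.≤-trans (ℚP.+-mono-≤ (h≤0 x x≢z) (sumOver-≤-peak z h xs uxs h≤0 hz≤B 0≤B))
                            (ℚP.≤-reflexive (ℚP.+-identityˡ B))

module _ {n : ℕ} where

  ΔΦΨ : ℕ → DLMState n → (L L' : List (Fin n)) → Fin n → ℚ
  ΔΦΨ r S L L' w =
    Δ-at r (pos (list S) w) (budget S w) (pexp (pos L w) ℕ.+ κc r) (pexp (pos L' w) ℕ.+ κc r)

  ΔΦΨ-moveToFront-other≤0 : ∀ r S {L} (z : Fin n) {w} → Unique L → w ≢ z →
    budget S w ℚ.≤ ⟦ pos (list S) w ⟧ → ΔΦΨ r S L (moveToFront z L) w ℚ.≤ 0ℚ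
  ΔΦΨ-moveToFront-other≤0 r S {L} z {w} uL w≢z b≤π = Δ-at≤0 r (pos (list S) w) b≤π
    (ℕP.+-monoˡ-≤ (κc r) (⌊log₂⌋-mono-≤ (pos≤pos-moveToFront z L uL w≢z)))

  ΔΦΨ-moveToFront-self≤ : ∀ r S L (z : Fin n) → 1 ≤ r →
    0ℚ ℚ.≤ budget S z → budget S z ℚ.≤ ⟦ pos (list S) z ⟧ →
    ΔΦΨ r S L (moveToFront z L) z ℚ.≤ ⟦ 30000 ℕ.* r ^ 2 ⟧ * ⟦ pos L z ∸ 1 ⟧
  ΔΦΨ-moveToFront-self≤ r S L z 1≤r 0≤b b≤π =
    subst (λ p → Δ-at r π b t (pexp p ℕ.+ κc r) ℚ.≤ ⟦ 30000 ℕ.* r ^ 2 ⟧ * ⟦ pos L z ∸ 1 ⟧)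
          (sym (pos-moveToFront-self z L))
          (Δ-at-front≤ r π (pos L z) 1≤r 0≤b b≤π)
    where
    π : ℕ
    π = pos (list S) z
    b : ℚ
    b = budget S z
    t : ℕ
    t = pexp (pos L z) ℕ.+ κc r

lemma12 : ∃ λ (C : ℕ) → ∀ (n r : ℕ) → 1 ≤ r →
    (L₀ : List (Fin n)) → L₀ ↭ allFin n →
    ∀ (S S' : DLMState n) (L* : List (Fin n)) (R : List (Fin n)) (z : Fin n) →
    Reachable r L₀ S L* → ValidRequest r R → DLMStep R S S' → z ∈ R →
    (Φ r S' (moveToFront z L*) - Φ r S' L*) + (Ψ r S' (moveToFront z L*) - Ψ r S' L*)
      ℚ.≤ ⟦ C ℕ.* r ^ 2 ⟧ * ⟦ pos L* z ∸ 1 ⟧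
lemma12 = 30000 , λ n r 1≤r L₀ L₀↭allFin S S' L* R z reach _ dlmStep _ →
  let L' = moveToFront z L*
      uL* = Reachable-unique L₀↭allFin reach
      b≤π = λ w → ℚP.<⇒≤ (DLMStep-budget<pos dlmStep w)
      0≤b = DLMStep-nonNeg dlmStep (Reachable-nonNeg reach)
  in ℚP.≤-trans
       (ℚP.≤-reflexive (sumOver-differences (Φz r S' L') (Φz r S' L*) (Ψz r S' L') (Ψz r S' L*) (allFin n)))
       (sumOver-≤-peak z (ΔΦΨ r S' L* L') (allFin n) (UniqueP.allFin⁺ n)
         (λ w w≢z → ΔΦΨ-moveToFront-other≤0 r S' z uL* w≢z (b≤π w))
         (ΔΦΨ-moveToFront-self≤ r S' L* z 1≤r (0≤b z) (b≤π z))
         (0≤p*q (0≤⟦⟧ (30000 ℕ.* r ^ 2)) (0≤⟦⟧ (pos L* z ∸ 1))))
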